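{- Let $r$ be even, let $c$ be a cycle in $G(r,n)$ of even length and even color, and let $h\in G(r,n)$. Then $$\mathrm{sign}(h^{ -1}ch)=\mathrm{sign}(c)+\sum_{j\in|h|^{ -1}(\mathrm{Supp}(c))}z_j(h)\in\mathbb{Z}_2.$$ In particular, if $g\in G(r,n)$ is a product of disjoint cycles of even length and even color, then $\mathrm{sign}(h^{ -1}gh)=\mathrm{sign}(g)+z(h)\in\mathbb{Z}_2$.
   Context: $\zeta_r=e^{2\pi i/r}$. $G(r,n)$ is the group of $n\times n$ monomial complex matrices whose nonzero entries are $r$-th roots of unity. For $g\in G(r,n)$ write $g=[\sigma_1^{z_1},\dots,\sigma_n^{z_n}]$ if the nonzero entry of row $j$ lies in column $\sigma_j$ and equals $\zeta_r^{z_j}$; $z_j(g)=z_j\in\mathbb{Z}_r$, $z(g)=\sum_jz_j(g)$, $|g|=[\sigma_1,\dots,\sigma_n]\in S_n$. A cycle of $g$ is $c=(a_1^{z_{a_1}},\dots,a_k^{z_{a_k}})$ where $(a_1,\dots,a_k)$ is a cycle of $|g|$ and $z_{a_i}=z_{a_i}(g)$; it is identified with the element of $G(r,n)$ acting as $g$ on $\mathrm{Supp}(c)=\{a_1,\dots,a_k\}$ and as the identity (with color $0$) elsewhere; its length is $k$, its color $\sum_iz_{a_i}$. For a cycle $c=(i_1^{z_{i_1}},\dots,i_{2d}^{z_{i_{2d}}})$ of even length and even color, its signature is $\mathrm{sign}(c)=z_{i_1}+z_{i_3}+\dots+z_{i_{2d-1}}=z_{i_2}+z_{i_4}+\dots+z_{i_{2d}}\in\mathbb{Z}_2$;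 the signature of a product of disjoint such cycles is the sum of their signatures. -}

module Defs where

open import Data.Nat using (ℕ; zero; suc; _+_; _∸_; NonZero)
open import Data.Nat.DivMod using (_mod_)
open import Data.Nat.Divisibility using (_∣_)
open import Data.Fin using (Fin; toℕ; _≟_)
open import Data.Fin.Permutation using (Permutation′; _⟨$⟩ʳ_; _⟨$⟩ˡ_; _∘ₚ_; flip)
open import Data.List using (List; []; _∷_; _++_; [_]; map; length; filter; allFin; concat)
open import Data.Nat.ListAction using (sum)
open import Data.List.Relation.Unary.Any using (any?)
open import Data.List.Membership.Propositional using (_∈_; _∉_)
open import Data.List.Relation.Unary.Unique.Propositional using (Unique)
open import Data.List.Relation.Unary.All using (All)
open import Data.List.Relation.Binary.Permutation.Propositional using (_↭_)
open import Data.Product using (_×_)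
open import Relation.Binary.PropositionalEquality using (_≡_; _≢_)

-- Colours in ℤ_r, represented by Fin r (r ≠ 0), with arithmetic mod r.

module _ {r : ℕ} ⦃ _ : NonZero r ⦄ where

  _+ᵣ_ : Fin r → Fin r → Fin r
  a +ᵣ b = (toℕ a + toℕ b) mod r

  -ᵣ_ : Fin r → Fin r
  -ᵣ a = (r ∸ toℕ a) mod r

-- The group G(r,n) of r-coloured permutations.
-- g = [σ₁^{z₁},…,σₙ^{zₙ}] : perm g ⟨$⟩ʳ j = σ_j = |g|(j), col g j = z_j(g).

record G (r n : ℕ) : Set where
  constructor mkG
  field
    perm : Permutation′ n
    col  : Fin n → Fin r

open G public

module _ {r n : ℕ} ⦃ _ : NonZero r ⦄ where

  -- group law:  |g h| = |g| ∘ |h| ,  z_j(g h) = z_j(h) + z_{|h|(j)}(g)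
  infixl 7 _·_
  infix 8 _⁻¹
  _·_ : G r n → G r n → G r n
  g · h = mkG (perm h ∘ₚ perm g) (λ j → col h j +ᵣ col g (perm h ⟨$⟩ʳ j))

  _⁻¹ : G r n → G r n
  g ⁻¹ = mkG (flip (perm g)) (λ j → -ᵣ col g (perm g ⟨$⟩ˡ j))

rotate : {A : Set} → List A → List A
rotate []       = []
rotate (x ∷ xs) = xs ++ [ x ]

-- The list (a₁,…,a_k) (k ≥ 1, distinct entries) is a cycle of |g|:
-- |g|(a_i) = a_{i+1}, |g|(a_k) = a₁.
IsCycleOf : {r n : ℕ} → G r n → List (Fin n) → Set
IsCycleOf g as = (as ≢ []) × Unique as × (map (perm g ⟨$⟩ʳ_) as ≡ rotate as)

-- g is itself the cycle (a₁^{z_{a₁}},…,a_k^{z_{a_k}}): it is a cycle of g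
-- and g is the identity with colour 0 outside {a₁,…,a_k}.
IsCycle : {r n : ℕ} → G r n → List (Fin n) → Set
IsCycle {n = n} c as =
  IsCycleOf c as × ((j : Fin n) → j ∉ as → (perm c ⟨$⟩ʳ j ≡ j) × (toℕ (col c j) ≡ 0))

colour : {r n : ℕ} → G r n → List (Fin n) → ℕ
colour g as = sum (map (λ a → toℕ (col g a)) as)

altSum : List ℕ → ℕ
altSum []           = 0
altSum (x ∷ [])     = x
altSum (x ∷ _ ∷ xs) = x + altSum xs

-- signature of the cycle: z_{a₁} + z_{a₃} + … (representative in ℕ, read mod 2)
sign : {r n : ℕ} → G r n → List (Fin n) → ℕ
sign g as = altSum (map (λ a → toℕ (col g a)) as)

EvenCycleOf : {r n : ℕ} → G r n → List (Fin n) → Set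
EvenCycleOf g as = IsCycleOf g as × (2 ∣ length as) × (2 ∣ colour g as)

IsCycleDecomp : {r n : ℕ} → G r n → List (List (Fin n)) → Set
IsCycleDecomp {n = n} g D = All (IsCycleOf g) D × (concat D ↭ allFin n)

signDecomp : {r n : ℕ} → G r n → List (List (Fin n)) → ℕ
signDecomp g D = sum (map (sign g) D)

sumOverPreimage : {r n : ℕ} → G r n → List (Fin n) → ℕ
sumOverPreimage {n = n} h S =
  sum (map (λ j → toℕ (col h j))
           (filter (λ j → any? (λ a → (perm h ⟨$⟩ʳ j) ≟ a) S) (allFin n)))

zTot : {r n : ℕ} → G r n → ℕ
zTot {n = n} h = sum (map (λ j → toℕ (col h j)) (allFin n))

infix 4 _≡₂_
_≡₂_ : ℕ → ℕ → Set
x ≡₂ y = x mod 2 ≡ y mod 2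

module Submission where

-- Conjugating by h carries a cycle bs of h⁻¹gh onto the cycle |h|(bs) of g, and the
-- colour of h⁻¹gh at j is z_j(h) + z_{|h|(j)}(g) − z_{j′}(h), with j′ the successor of j on bs. For r even
-- we may read colours mod 2, so the signature of bs (the sum over its odd positions) is the signature
-- of |h|(bs) plus the h-colours at the odd positions plus those at the even positions, i.e. plus all
-- h-colours on bs. The signature of an even cycle of even colour does not depend on where the cycle
-- is started, because the sums over odd and over even positions add up to the even colour; hence
-- |h|(bs) has the same signature as the cycle of g it coincides with up to rotation. Summing over a
-- full cycle decomposition, the h-colours add up to z(h).

open import Defs
open import Data.Nat using (ℕ; zero; suc; _+_; _*_; _∸_; NonZero; parity)
open import Data.Nat.Properties using (+-assoc; +-comm; +-identityʳ; m∸n+n≡m; <⇒≤; +-commutativeSemigroup)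
open import Data.Nat.DivMod using (_%_; _/_; m≡m%n+[m/n]*n; m%n<n)
open import Data.Nat.Divisibility using (_∣_; divides; ∣-refl; ∣-trans; n∣m*n; ∣m+n∣m⇒∣n; ∣1⇒≡1)
open import Data.Nat.ListAction using (sum)
open import Data.Nat.ListAction.Properties using (sum-↭; sum-++)
open import Data.Parity.Base as ℙ using (0ℙ)
import Data.Parity.Properties as ℙ
open import Data.Fin using (Fin; toℕ; _≟_)
open import Data.Fin.Properties using (toℕ-fromℕ<; toℕ<n)
open import Data.Fin.Permutation using (_⟨$⟩ʳ_; _⟨$⟩ˡ_; inverseʳ; inverseˡ)
open import Data.List using (List; []; _∷_; _++_; [_]; map; length; concat; allFin; filter)
open import Data.List.Properties using (map-++; map-∘; map-cong; length-map; concat-map; ++-assoc; ++-identityʳ; ∷-injective; ∷-injectiveˡ)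
open import Data.List.Relation.Unary.All as All using (All; []; _∷_)
open import Data.List.Relation.Unary.All.Properties using () renaming (map⁺ to All-map⁺; map⁻ to All-map⁻)
open import Data.List.Relation.Unary.Any using (here; any?)
open import Data.List.Relation.Unary.Unique.Propositional using (Unique)
open import Data.List.Relation.Unary.AllPairs using (_∷_)
import Data.List.Relation.Unary.Unique.Propositional.Properties as Unique
open import Data.List.Membership.Propositional using (_∈_)
open import Data.List.Membership.Propositional.Properties
  using (∈-∃++; ∈-map⁺; ∈-map⁻; ∈-concat⁻′; ∈-filter⁺; ∈-filter⁻; ∈-allFin)
open import Data.List.Membership.Propositional.Properties.WithK using (unique∧set⇒bag)
open import Data.List.Relation.Binary.BagAndSetEquality using (∼bag⇒↭)
open import Data.List.Relation.Binary.Permutation.Propositional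
  using (_↭_; ↭-refl; ↭-sym; ↭-trans; ↭-reflexive; prep; swap; ↭⇒↭ₛ)
open import Data.List.Relation.Binary.Permutation.Propositional.Properties
  using (All-resp-↭; ∈-resp-↭; map⁺; ↭-length; ∷↭∷ʳ; shift; shifts; ++⁺ˡ; ++⁺ʳ; drop-∷; ¬x∷xs↭[])
import Data.List.Relation.Binary.Permutation.Setoid.Properties as Permutationₛ
open import Data.Product using (_×_; _,_; ∃₂; proj₁; proj₂)
open import Data.Empty using (⊥-elim)
open import Function using (_∘_; mk⇔)
open import Relation.Nullary using (¬_; yes; no)
open import Relation.Binary.PropositionalEquality
  using (_≡_; _≢_; refl; sym; trans; cong; cong₂; subst; setoid; module ≡-Reasoning)
open import Algebra.Properties.CommutativeSemigroup +-commutativeSemigroup using (interchange)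

open ≡-Reasoning

private variable
  A : Set

p+q≡0ℙ⇒p≡q : ∀ {p q} → p ℙ.+ q ≡ 0ℙ → p ≡ q
p+q≡0ℙ⇒p≡q {p} {q} e = ℙ.+-cancelʳ-≡ q p q (trans e (sym (ℙ.p+p≡0ℙ q)))

parity-even : ∀ {m} → 2 ∣ m → parity m ≡ 0ℙ
parity-even (divides q refl) = trans (ℙ.*-homo-* q 2) (ℙ.*-zeroʳ (parity q))

parity-+-cong : ∀ a a′ b b′ → parity a ≡ parity a′ → parity b ≡ parity b′ → parity (a + b) ≡ parity (a′ + b′)
parity-+-cong a a′ b b′ a≡a′ b≡b′ = begin
  parity (a + b)                ≡⟨ ℙ.+-homo-+ a b ⟩
  parity a ℙ.+ parity b         ≡⟨ cong₂ ℙ._+_ a≡a′ b≡b′ ⟩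
  parity a′ ℙ.+ parity b′       ≡⟨ sym (ℙ.+-homo-+ a′ b′) ⟩
  parity (a′ + b′)              ∎

parity-% : ∀ {r} .⦃ _ : NonZero r ⦄ → 2 ∣ r → ∀ m → parity (m % r) ≡ parity m
parity-% {r} 2∣r m = begin
  parity (m % r)                           ≡⟨ sym (ℙ.+-identityʳ _) ⟩
  parity (m % r) ℙ.+ 0ℙ                    ≡⟨ cong (parity (m % r) ℙ.+_) (sym (parity-even 2∣[m/r]*r)) ⟩
  parity (m % r) ℙ.+ parity (m / r * r)    ≡⟨ sym (ℙ.+-homo-+ (m % r) _) ⟩
  parity (m % r + m / r * r)               ≡⟨ cong parity (sym (m≡m%n+[m/n]*n m r)) ⟩
  parity m                                 ∎
  where
  2∣[m/r]*r : 2 ∣ m / r * r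
  2∣[m/r]*r = ∣-trans 2∣r (n∣m*n (m / r))

-- suc (suc m) mod 2 reduces to m mod 2, which makes the recursive clauses typecheck.
parity⇒≡₂ : ∀ m n → parity m ≡ parity n → m ≡₂ n
parity⇒≡₂ zero          zero          _  = refl
parity⇒≡₂ (suc zero)    (suc zero)    _  = refl
parity⇒≡₂ zero          (suc zero)    ()
parity⇒≡₂ (suc zero)    zero          ()
parity⇒≡₂ (suc (suc m)) n             eq = parity⇒≡₂ m n eq
parity⇒≡₂ m             (suc (suc n)) eq = parity⇒≡₂ m n eq

module _ {r : ℕ} ⦃ _ : NonZero r ⦄ (2∣r : 2 ∣ r) where

  parity-+ᵣ : (a b : Fin r) → parity (toℕ (a +ᵣ b)) ≡ parity (toℕ a) ℙ.+ parity (toℕ b)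
  parity-+ᵣ a b = begin
    parity (toℕ (a +ᵣ b))           ≡⟨ cong parity (toℕ-fromℕ< (m%n<n (toℕ a + toℕ b) r)) ⟩
    parity ((toℕ a + toℕ b) % r)    ≡⟨ parity-% 2∣r _ ⟩
    parity (toℕ a + toℕ b)          ≡⟨ ℙ.+-homo-+ (toℕ a) _ ⟩
    parity (toℕ a) ℙ.+ parity (toℕ b) ∎

  parity--ᵣ : (a : Fin r) → parity (toℕ (-ᵣ a)) ≡ parity (toℕ a)
  parity--ᵣ a = begin
    parity (toℕ (-ᵣ a))      ≡⟨ cong parity (toℕ-fromℕ< (m%n<n (r ∸ toℕ a) r)) ⟩
    parity ((r ∸ toℕ a) % r) ≡⟨ parity-% 2∣r _ ⟩
    parity (r ∸ toℕ a)       ≡⟨ p+q≡0ℙ⇒p≡q r-a+a ⟩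
    parity (toℕ a)           ∎
    where
    r-a+a : parity (r ∸ toℕ a) ℙ.+ parity (toℕ a) ≡ 0ℙ
    r-a+a = begin
      parity (r ∸ toℕ a) ℙ.+ parity (toℕ a) ≡⟨ sym (ℙ.+-homo-+ (r ∸ toℕ a) _) ⟩
      parity (r ∸ toℕ a + toℕ a)          ≡⟨ cong parity (m∸n+n≡m (<⇒≤ (toℕ<n a))) ⟩
      parity r                            ≡⟨ parity-even 2∣r ⟩
      0ℙ                                  ∎

2∤1 : ¬ 2 ∣ 1
2∤1 2∣1 with ∣1⇒≡1 2∣1
... | ()

2∣2+n⇒2∣n : ∀ {n} → 2 ∣ 2 + n → 2 ∣ n
2∣2+n⇒2∣n 2∣2+n = ∣m+n∣m⇒∣n 2∣2+n ∣-refl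

altSum-∷ : ∀ x xs → altSum (x ∷ xs) + altSum xs ≡ sum (x ∷ xs)
altSum-∷ x []       = refl
altSum-∷ x (y ∷ xs) = begin
  x + altSum xs + altSum (y ∷ xs)    ≡⟨ +-assoc x _ _ ⟩
  x + (altSum xs + altSum (y ∷ xs))  ≡⟨ cong (x +_) (+-comm (altSum xs) _) ⟩
  x + (altSum (y ∷ xs) + altSum xs)  ≡⟨ cong (x +_) (altSum-∷ y xs) ⟩
  x + sum (y ∷ xs)                   ∎

altSum-∷-++-even : ∀ x xs v → 2 ∣ length xs → altSum (x ∷ xs ++ [ v ]) ≡ altSum (x ∷ xs)
altSum-∷-++-even x []           v _      = +-identityʳ x
altSum-∷-++-even x (_ ∷ [])     v 2∣1    = ⊥-elim (2∤1 2∣1)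
altSum-∷-++-even x (_ ∷ y ∷ xs) v 2∣2+n = cong (x +_) (altSum-∷-++-even y xs v (2∣2+n⇒2∣n 2∣2+n))

altSum-rotate : ∀ xs → 2 ∣ length xs → altSum (rotate xs) + altSum xs ≡ sum xs
altSum-rotate []           _      = refl
altSum-rotate (_ ∷ [])     2∣1    = ⊥-elim (2∤1 2∣1)
altSum-rotate (x ∷ y ∷ xs) 2∣2+n = begin
  altSum (y ∷ xs ++ [ x ]) + altSum (x ∷ y ∷ xs)
    ≡⟨ cong (_+ altSum (x ∷ y ∷ xs)) (altSum-∷-++-even y xs x (2∣2+n⇒2∣n 2∣2+n)) ⟩
  altSum (y ∷ xs) + altSum (x ∷ y ∷ xs)  ≡⟨ +-comm (altSum (y ∷ xs)) _ ⟩
  altSum (x ∷ y ∷ xs) + altSum (y ∷ xs)  ≡⟨ altSum-∷ x (y ∷ xs) ⟩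
  sum (x ∷ y ∷ xs)                       ∎

parity-altSum-rotate : ∀ xs → 2 ∣ length xs → 2 ∣ sum xs →
                       parity (altSum (rotate xs)) ≡ parity (altSum xs)
parity-altSum-rotate xs 2∣len 2∣sum = p+q≡0ℙ⇒p≡q (begin
  parity (altSum (rotate xs)) ℙ.+ parity (altSum xs) ≡⟨ sym (ℙ.+-homo-+ (altSum (rotate xs)) _) ⟩
  parity (altSum (rotate xs) + altSum xs)            ≡⟨ cong parity (altSum-rotate xs 2∣len) ⟩
  parity (sum xs)                                    ≡⟨ parity-even 2∣sum ⟩
  0ℙ                                                 ∎)

altSum-map-+ : ∀ (f g : A → ℕ) xs →
               altSum (map (λ x → f x + g x) xs) ≡ altSum (map f xs) + altSum (map g xs)
altSum-map-+ f g []           = refl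
altSum-map-+ f g (x ∷ [])     = refl
altSum-map-+ f g (x ∷ _ ∷ xs) = trans (cong (f x + g x +_) (altSum-map-+ f g xs))
                                      (interchange (f x) (g x) _ _)

parity-altSum-map : ∀ {f g : A → ℕ} → (∀ x → parity (f x) ≡ parity (g x)) →
                    ∀ xs → parity (altSum (map f xs)) ≡ parity (altSum (map g xs))
parity-altSum-map f≡g []           = refl
parity-altSum-map f≡g (x ∷ [])     = f≡g x
parity-altSum-map {f = f} {g} f≡g (x ∷ _ ∷ xs) =
  parity-+-cong (f x) (g x) (altSum (map f xs)) (altSum (map g xs)) (f≡g x) (parity-altSum-map f≡g xs)

rotate-↭ : (xs : List A) → rotate xs ↭ xs
rotate-↭ []       = ↭-refl
rotate-↭ (x ∷ xs) = ↭-sym (∷↭∷ʳ x xs)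

map-rotate : ∀ {B : Set} (f : A → B) xs → map f (rotate xs) ≡ rotate (map f xs)
map-rotate f []       = refl
map-rotate f (x ∷ xs) = map-++ f xs [ x ]

rotateBy : ℕ → List A → List A
rotateBy zero    xs = xs
rotateBy (suc i) xs = rotateBy i (rotate xs)

rotateBy-↭ : ∀ i (xs : List A) → rotateBy i xs ↭ xs
rotateBy-↭ zero    xs = ↭-refl
rotateBy-↭ (suc i) xs = ↭-trans (rotateBy-↭ i (rotate xs)) (rotate-↭ xs)

map-rotateBy : ∀ {B : Set} (f : A → B) i xs → map f (rotateBy i xs) ≡ rotateBy i (map f xs)
map-rotateBy f zero    xs = refl
map-rotateBy f (suc i) xs = trans (map-rotateBy f i (rotate xs)) (cong (rotateBy i) (map-rotate f xs))

rotateBy-++ : (xs ys : List A) → rotateBy (length xs) (xs ++ ys) ≡ ys ++ xs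
rotateBy-++ []       ys = sym (++-identityʳ ys)
rotateBy-++ (x ∷ xs) ys = begin
  rotateBy (length xs) ((xs ++ ys) ++ [ x ])  ≡⟨ cong (rotateBy (length xs)) (++-assoc xs ys [ x ]) ⟩
  rotateBy (length xs) (xs ++ ys ++ [ x ])    ≡⟨ rotateBy-++ xs (ys ++ [ x ]) ⟩
  (ys ++ [ x ]) ++ xs                         ≡⟨ ++-assoc ys [ x ] xs ⟩
  ys ++ x ∷ xs                                ∎

∈⇒rotateBy≡∷ : ∀ {x : A} {xs} → x ∈ xs → ∃₂ λ i ys → rotateBy i xs ≡ x ∷ ys
∈⇒rotateBy≡∷ x∈xs with ∈-∃++ x∈xs
... | ys , zs , refl = length ys , zs ++ ys , rotateBy-++ ys (_ ∷ zs)

parity-altSum-rotateBy : ∀ i xs → 2 ∣ length xs → 2 ∣ sum xs →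
                         parity (altSum (rotateBy i xs)) ≡ parity (altSum xs)
parity-altSum-rotateBy zero    xs _     _     = refl
parity-altSum-rotateBy (suc i) xs 2∣len 2∣sum = trans
  (parity-altSum-rotateBy i (rotate xs) (subst (2 ∣_) (sym (↭-length (rotate-↭ xs))) 2∣len)
                                        (subst (2 ∣_) (sym (sum-↭ (rotate-↭ xs))) 2∣sum))
  (parity-altSum-rotate xs 2∣len 2∣sum)

Unique-resp-↭ : {xs ys : List A} → xs ↭ ys → Unique xs → Unique ys
Unique-resp-↭ {A = A} xs↭ys = Permutationₛ.Unique-resp-↭ (setoid A) (↭⇒↭ₛ xs↭ys)

unique-⇔⇒↭ : {xs ys : List A} → Unique xs → Unique ys → (∀ x → x ∈ xs → x ∈ ys) → (∀ x → x ∈ ys → x ∈ xs) →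
             xs ↭ ys
unique-⇔⇒↭ uxs uys to from = ∼bag⇒↭ (unique∧set⇒bag uxs uys (mk⇔ (to _) (from _)))

concat⁺ : {xss yss : List (List A)} → xss ↭ yss → concat xss ↭ concat yss
concat⁺ _↭_.refl           = ↭-refl
concat⁺ (prep xs p)        = ++⁺ˡ xs (concat⁺ p)
concat⁺ (swap xs ys p)     = ↭-trans (shifts xs ys) (++⁺ˡ ys (++⁺ˡ xs (concat⁺ p)))
concat⁺ (_↭_.trans p q)    = ↭-trans (concat⁺ p) (concat⁺ q)

++-cancelˡ : ∀ (xs : List A) {ys zs} → xs ++ ys ↭ xs ++ zs → ys ↭ zs
++-cancelˡ []       p = p
++-cancelˡ (x ∷ xs) p = ++-cancelˡ xs (drop-∷ p)

module _ (σ : A → A) where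

  Cyclic : List A → Set
  Cyclic xs = map σ xs ≡ rotate xs

  cyclic-rotate : ∀ xs → Cyclic xs → Cyclic (rotate xs)
  cyclic-rotate []       _   = refl
  cyclic-rotate (x ∷ xs) cyc = trans (map-rotate σ (x ∷ xs)) (cong rotate cyc)

  cyclic-rotateBy : ∀ i xs → Cyclic xs → Cyclic (rotateBy i xs)
  cyclic-rotateBy zero    xs cyc = cyc
  cyclic-rotateBy (suc i) xs cyc = cyclic-rotateBy i (rotate xs) (cyclic-rotate xs cyc)

  -- x ∷ ys lists x, σ x, σ² x, … up to just before the first visit to e, so it is determined by x and e.
  path-unique : ∀ {x e} ys zs → map σ (x ∷ ys) ≡ ys ++ [ e ] → map σ (x ∷ zs) ≡ zs ++ [ e ] →
                All (e ≢_) ys → All (e ≢_) zs → ys ≡ zs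
  path-unique []       []       _ _ _         _         = refl
  path-unique []       (z ∷ zs) p q _         (e≢z ∷ _) = ⊥-elim (e≢z (trans (sym (∷-injectiveˡ p)) (∷-injectiveˡ q)))
  path-unique (y ∷ ys) []       p q (e≢y ∷ _) _         = ⊥-elim (e≢y (trans (sym (∷-injectiveˡ q)) (∷-injectiveˡ p)))
  path-unique (y ∷ ys) (z ∷ zs) p q (_ ∷ e∉ys) (_ ∷ e∉zs) with ∷-injective p | ∷-injective q
  ... | refl , p′ | refl , q′ = cong (y ∷_) (path-unique ys zs p′ q′ e∉ys e∉zs)

  meeting-cycles⇒rotateBy≡ : ∀ {x xs ys} → Unique xs → Unique ys → Cyclic xs → Cyclic ys →
                             x ∈ xs → x ∈ ys → ∃₂ λ i j → rotateBy i xs ≡ rotateBy j ys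
  meeting-cycles⇒rotateBy≡ {x} {xs} {ys} uxs uys cxs cys x∈xs x∈ys
    with ∈⇒rotateBy≡∷ x∈xs | ∈⇒rotateBy≡∷ x∈ys
  ... | i , xs′ , xs≡ | j , ys′ , ys≡ = i , j , (begin
    rotateBy i xs  ≡⟨ xs≡ ⟩
    x ∷ xs′        ≡⟨ cong (x ∷_) (path-unique xs′ ys′ cxs′ cys′ x∉xs′ x∉ys′) ⟩
    x ∷ ys′        ≡⟨ sym ys≡ ⟩
    rotateBy j ys  ∎)
    where
    cxs′ : Cyclic (x ∷ xs′)
    cxs′ = subst Cyclic xs≡ (cyclic-rotateBy i xs cxs)
    cys′ : Cyclic (x ∷ ys′)
    cys′ = subst Cyclic ys≡ (cyclic-rotateBy j ys cys)
    x∉xs′ : All (x ≢_) xs′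
    x∉xs′ with subst Unique xs≡ (Unique-resp-↭ (↭-sym (rotateBy-↭ i xs)) uxs)
    ... | x∉ ∷ _ = x∉
    x∉ys′ : All (x ≢_) ys′
    x∉ys′ with subst Unique ys≡ (Unique-resp-↭ (↭-sym (rotateBy-↭ j ys)) uys)
    ... | x∉ ∷ _ = x∉

z : ∀ {r n} → G r n → Fin n → ℕ
z g j = toℕ (col g j)

module _ {r n : ℕ} (g : G r n) where

  head-moved : ∀ {a a′ as} → IsCycleOf g (a ∷ a′ ∷ as) → perm g ⟨$⟩ʳ a ≢ a
  head-moved (_ , ((a≢a′ ∷ _) ∷ _) , cyc) σa≡a = a≢a′ (trans (sym σa≡a) (∷-injectiveˡ cyc))

  moved⇒∈ : ∀ {as j} → IsCycle g as → perm g ⟨$⟩ʳ j ≢ j → j ∈ as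
  moved⇒∈ {as} {j} (_ , fixed) moved with any? (j ≟_) as
  ... | yes j∈as = j∈as
  ... | no  j∉as = ⊥-elim (moved (proj₁ (fixed j j∉as)))

  EvenCycleOf-resp-↭ : ∀ {as bs} → EvenCycleOf g as → IsCycleOf g bs → as ↭ bs → EvenCycleOf g bs
  EvenCycleOf-resp-↭ (_ , 2∣len , 2∣col) cyc as↭bs =
    cyc , subst (2 ∣_) (↭-length as↭bs) 2∣len , subst (2 ∣_) (sum-↭ (map⁺ (z g) as↭bs)) 2∣col

  sign-meeting-cycles : ∀ {as bs a} → EvenCycleOf g as → IsCycleOf g bs → a ∈ as → a ∈ bs →
                        as ↭ bs × parity (sign g bs) ≡ parity (sign g as)
  sign-meeting-cycles {as} {bs} ev@((_ , uas , cas) , 2∣len , 2∣col) cbs@(_ , ubs , cycbs) a∈as a∈bs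
    with meeting-cycles⇒rotateBy≡ (perm g ⟨$⟩ʳ_) uas ubs cas cycbs a∈as a∈bs
  ... | i , j , rot≡ = as↭bs , (begin
    parity (altSum (map (z g) bs))               ≡⟨ parity-altSum-rotateBy j _ (len-even ev′) (proj₂ (proj₂ ev′)) ⟨
    parity (altSum (rotateBy j (map (z g) bs)))  ≡⟨ cong (parity ∘ altSum) (map-rotateBy (z g) j bs) ⟨
    parity (altSum (map (z g) (rotateBy j bs)))  ≡⟨ cong (parity ∘ altSum ∘ map (z g)) rot≡ ⟨
    parity (altSum (map (z g) (rotateBy i as)))  ≡⟨ cong (parity ∘ altSum) (map-rotateBy (z g) i as) ⟩
    parity (altSum (rotateBy i (map (z g) as)))  ≡⟨ parity-altSum-rotateBy i _ (len-even ev) 2∣col ⟩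
    parity (altSum (map (z g) as))               ∎)
    where
    as↭bs : as ↭ bs
    as↭bs = ↭-trans (↭-sym (rotateBy-↭ i as)) (↭-trans (↭-reflexive rot≡) (rotateBy-↭ j bs))
    ev′ : EvenCycleOf g bs
    ev′ = EvenCycleOf-resp-↭ ev cbs as↭bs
    len-even : ∀ {cs} → EvenCycleOf g cs → 2 ∣ length (map (z g) cs)
    len-even {cs} (_ , 2∣len′ , _) = subst (2 ∣_) (sym (length-map (z g) cs)) 2∣len′

  signDecomp-↭ : ∀ {D D′} → All (EvenCycleOf g) D → All (IsCycleOf g) D′ → concat D ↭ concat D′ →
                 All (EvenCycleOf g) D′ × parity (signDecomp g D′) ≡ parity (signDecomp g D)
  signDecomp-↭ {D = []}     {[]}          _                    _              _ = [] , refl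
  signDecomp-↭ {D = []}     {[] ∷ _}      _                    ((ne , _) ∷ _) _ = ⊥-elim (ne refl)
  signDecomp-↭ {D = []}     {(_ ∷ _) ∷ _} _                    _              p = ⊥-elim (¬x∷xs↭[] (↭-sym p))
  signDecomp-↭ {D = [] ∷ _} (((ne , _) , _) ∷ _) _ _ = ⊥-elim (ne refl)
  signDecomp-↭ {D = (a ∷ as) ∷ D} {D′} (ev ∷ evD) cD′ p
    with ∈-concat⁻′ D′ (∈-resp-↭ p (here refl))
  ... | bs , a∈bs , bs∈D′ with ∈-∃++ bs∈D′
  ... | E₁ , E₂ , refl =
    All-resp-↭ (↭-sym D′↭bs∷E) (EvenCycleOf-resp-↭ ev cbs as↭bs ∷ proj₁ recursion) , (begin
      parity (signDecomp g (E₁ ++ bs ∷ E₂))       ≡⟨ cong parity (sum-↭ (map⁺ (sign g) D′↭bs∷E)) ⟩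
      parity (sign g bs + signDecomp g E)         ≡⟨ parity-+-cong (sign g bs) (sign g (a ∷ as))
                                                                   (signDecomp g E) (signDecomp g D)
                                                                   (proj₂ meeting) (proj₂ recursion) ⟩
      parity (sign g (a ∷ as) + signDecomp g D)   ∎)
    where
    E = E₁ ++ E₂
    D′↭bs∷E : E₁ ++ bs ∷ E₂ ↭ bs ∷ E
    D′↭bs∷E = shift bs E₁ E₂
    cbs = All.head (All-resp-↭ D′↭bs∷E cD′)
    meeting = sign-meeting-cycles ev cbs (here refl) a∈bs
    as↭bs = proj₁ meeting
    D↭E : concat D ↭ concat E
    D↭E = ++-cancelˡ (a ∷ as) (↭-trans p (↭-trans (concat⁺ D′↭bs∷E) (++⁺ʳ (concat E) (↭-sym as↭bs))))
    recursion = signDecomp-↭ evD (All.tail (All-resp-↭ D′↭bs∷E cD′)) D↭E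

module ConjugationBy {r n : ℕ} ⦃ _ : NonZero r ⦄ (h : G r n) where

  ĥ : Fin n → Fin n
  ĥ j = perm h ⟨$⟩ʳ j

  ĥ-injective : ∀ {i j} → ĥ i ≡ ĥ j → i ≡ j
  ĥ-injective {i} {j} ĥi≡ĥj = begin
    i                          ≡⟨ inverseˡ (perm h) ⟨
    perm h ⟨$⟩ˡ ĥ i            ≡⟨ cong (perm h ⟨$⟩ˡ_) ĥi≡ĥj ⟩
    perm h ⟨$⟩ˡ ĥ j            ≡⟨ inverseˡ (perm h) ⟩
    j                          ∎

  ĥ-allFin : map ĥ (allFin n) ↭ allFin n
  ĥ-allFin = unique-⇔⇒↭ (Unique.map⁺ ĥ-injective (Unique.allFin⁺ n)) (Unique.allFin⁺ n)
    (λ j _ → ∈-allFin j)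
    (λ j _ → subst (_∈ map ĥ (allFin n)) (inverseʳ (perm h)) (∈-map⁺ ĥ (∈-allFin (perm h ⟨$⟩ˡ j))))

  ĥ-∈-map⁻ : ∀ {j bs} → ĥ j ∈ map ĥ bs → j ∈ bs
  ĥ-∈-map⁻ ĥj∈ with ∈-map⁻ ĥ ĥj∈
  ... | _ , j′∈bs , ĥj≡ĥj′ = subst (_∈ _) (sym (ĥ-injective ĥj≡ĥj′)) j′∈bs

  sumOverPreimage-↭ : ∀ {as bs} → Unique bs → as ↭ map ĥ bs → sumOverPreimage h as ≡ sum (map (z h) bs)
  sumOverPreimage-↭ {as} {bs} ubs as↭ĥbs = sum-↭ (map⁺ (z h) preimage↭bs)
    where
    P? = λ j → any? (λ a → ĥ j ≟ a) as
    preimage↭bs : filter P? (allFin n) ↭ bs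
    preimage↭bs = unique-⇔⇒↭ (Unique.filter⁺ P? (Unique.allFin⁺ n)) ubs
      (λ j j∈ → ĥ-∈-map⁻ (∈-resp-↭ as↭ĥbs (proj₂ (∈-filter⁻ P? {xs = allFin n} j∈))))
      (λ j j∈bs → ∈-filter⁺ P? (∈-allFin j) (∈-resp-↭ (↭-sym as↭ĥbs) (∈-map⁺ ĥ j∈bs)))

  module _ (g : G r n) where

    gʰ : G r n
    gʰ = (h ⁻¹ · g) · h

    ĥ-intertwines : ∀ j → ĥ (perm gʰ ⟨$⟩ʳ j) ≡ perm g ⟨$⟩ʳ ĥ j
    ĥ-intertwines j = inverseʳ (perm h)

    cycle-map-ĥ : ∀ {bs} → IsCycleOf gʰ bs → IsCycleOf g (map ĥ bs)
    cycle-map-ĥ {[]}     (bs≢[] , _) = ⊥-elim (bs≢[] refl)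
    cycle-map-ĥ {b ∷ bs} (_ , ubs , cyc) = (λ ()) , Unique.map⁺ ĥ-injective ubs , (begin
      map (perm g ⟨$⟩ʳ_) (map ĥ (b ∷ bs))   ≡⟨ map-∘ (b ∷ bs) ⟨
      map (λ j → perm g ⟨$⟩ʳ ĥ j) (b ∷ bs)  ≡⟨ map-cong (sym ∘ ĥ-intertwines) (b ∷ bs) ⟩
      map (λ j → ĥ (perm gʰ ⟨$⟩ʳ j)) (b ∷ bs) ≡⟨ map-∘ (b ∷ bs) ⟩
      map ĥ (map (perm gʰ ⟨$⟩ʳ_) (b ∷ bs))  ≡⟨ cong (map ĥ) cyc ⟩
      map ĥ (rotate (b ∷ bs))               ≡⟨ map-rotate ĥ (b ∷ bs) ⟩
      rotate (map ĥ (b ∷ bs))               ∎)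

    module _ (2∣r : 2 ∣ r) where

      -- z_j(h⁻¹gh) = z_j(h) + z_{|h|(j)}(g) − z_{j′}(h), where j′ is the image of j under |h⁻¹gh|;
      -- since r is even, the subtraction does not change the parity.
      parity-z-gʰ : ∀ j → parity (z gʰ j) ≡ parity (z h j + (z g (ĥ j) + z h (perm gʰ ⟨$⟩ʳ j)))
      parity-z-gʰ j = begin
        parity (toℕ (col h j +ᵣ (col g (ĥ j) +ᵣ (-ᵣ col h j′))))
          ≡⟨ parity-+ᵣ 2∣r (col h j) _ ⟩
        parity (z h j) ℙ.+ parity (toℕ (col g (ĥ j) +ᵣ (-ᵣ col h j′)))
          ≡⟨ cong (parity (z h j) ℙ.+_) (parity-+ᵣ 2∣r (col g (ĥ j)) _) ⟩
        parity (z h j) ℙ.+ (parity (z g (ĥ j)) ℙ.+ parity (toℕ (-ᵣ col h j′)))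
          ≡⟨ cong (λ p → parity (z h j) ℙ.+ (parity (z g (ĥ j)) ℙ.+ p)) (parity--ᵣ 2∣r (col h j′)) ⟩
        parity (z h j) ℙ.+ (parity (z g (ĥ j)) ℙ.+ parity (z h j′))
          ≡⟨ cong (parity (z h j) ℙ.+_) (ℙ.+-homo-+ (z g (ĥ j)) _) ⟨
        parity (z h j) ℙ.+ parity (z g (ĥ j) + z h j′)
          ≡⟨ ℙ.+-homo-+ (z h j) _ ⟨
        parity (z h j + (z g (ĥ j) + z h j′)) ∎
        where j′ = perm gʰ ⟨$⟩ʳ j

      parity-sign-gʰ : ∀ {bs} → IsCycleOf gʰ bs → 2 ∣ length bs →
                parity (sign gʰ bs) ≡ parity (sign g (map ĥ bs) + sum (map (z h) bs))
      parity-sign-gʰ {bs} (_ , _ , cyc) 2∣len = begin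
        parity (altSum (map (z gʰ) bs))
          ≡⟨ parity-altSum-map parity-z-gʰ bs ⟩
        parity (altSum (map (λ j → z h j + (z g (ĥ j) + z h (τ j))) bs))
          ≡⟨ cong parity altSum-split ⟩
        parity (sign g (map ĥ bs) + sum (map (z h) bs)) ∎
        where
        τ = perm gʰ ⟨$⟩ʳ_
        Z = altSum (map (z h) bs)
        T = altSum (map (z h ∘ τ) bs)
        -- T and Z sum the colours of h over the even and the odd positions of the cycle bs
        T+Z : T + Z ≡ sum (map (z h) bs)
        T+Z = begin
          T + Z                                  ≡⟨ cong (λ l → altSum l + Z) (map-∘ bs) ⟩
          altSum (map (z h) (map τ bs)) + Z      ≡⟨ cong (λ l → altSum (map (z h) l) + Z) cyc ⟩
          altSum (map (z h) (rotate bs)) + Z     ≡⟨ cong (λ l → altSum l + Z) (map-rotate (z h) bs) ⟩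
          altSum (rotate (map (z h) bs)) + Z     ≡⟨ altSum-rotate (map (z h) bs) (subst (2 ∣_) (sym (length-map (z h) bs)) 2∣len) ⟩
          sum (map (z h) bs)                     ∎
        altSum-split : altSum (map (λ j → z h j + (z g (ĥ j) + z h (τ j))) bs) ≡
                       sign g (map ĥ bs) + sum (map (z h) bs)
        altSum-split = begin
          altSum (map (λ j → z h j + (z g (ĥ j) + z h (τ j))) bs)
            ≡⟨ altSum-map-+ (z h) _ bs ⟩
          Z + altSum (map (λ j → z g (ĥ j) + z h (τ j)) bs)
            ≡⟨ cong (Z +_) (altSum-map-+ (z g ∘ ĥ) (z h ∘ τ) bs) ⟩
          Z + (altSum (map (z g ∘ ĥ) bs) + T)
            ≡⟨ +-comm Z _ ⟩
          altSum (map (z g ∘ ĥ) bs) + T + Z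
            ≡⟨ +-assoc (altSum (map (z g ∘ ĥ) bs)) T Z ⟩
          altSum (map (z g ∘ ĥ) bs) + (T + Z)
            ≡⟨ cong₂ (λ l s → altSum l + s) (map-∘ bs) T+Z ⟩
          sign g (map ĥ bs) + sum (map (z h) bs) ∎

      sign-conjugate-cycle : ∀ {as bs} → IsCycle g as → 2 ∣ length as → 2 ∣ colour g as → IsCycle gʰ bs →
                             sign gʰ bs ≡₂ sign g as + sumOverPreimage h as
      sign-conjugate-cycle {[]}              ((as≢[] , _) , _) _ _ _ = ⊥-elim (as≢[] refl)
      sign-conjugate-cycle {_ ∷ []}          _ 2∣1 _ _               = ⊥-elim (2∤1 2∣1)
      sign-conjugate-cycle {as@(a ∷ _ ∷ _)} {bs} (cyc , _) 2∣len 2∣col cʰ@(cycʰ , _) =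
        parity⇒≡₂ (sign gʰ bs) (sign g as + sumOverPreimage h as) (begin
          parity (sign gʰ bs)
            ≡⟨ parity-sign-gʰ cycʰ (subst (2 ∣_) (trans (↭-length as↭ĥbs) (length-map ĥ bs)) 2∣len) ⟩
          parity (sign g (map ĥ bs) + sum (map (z h) bs))
            ≡⟨ parity-+-cong (sign g (map ĥ bs)) (sign g as) (sum (map (z h) bs)) (sumOverPreimage h as)
                             (proj₂ meeting) (cong parity (sym (sumOverPreimage-↭ (proj₁ (proj₂ cycʰ)) as↭ĥbs))) ⟩
          parity (sign g as + sumOverPreimage h as) ∎)
        where
        j = perm h ⟨$⟩ˡ a
        ĥj≡a : ĥ j ≡ a
        ĥj≡a = inverseʳ (perm h)
        j-moved : perm gʰ ⟨$⟩ʳ j ≢ j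
        j-moved τj≡j = head-moved g cyc (begin
          perm g ⟨$⟩ʳ a      ≡⟨ cong (perm g ⟨$⟩ʳ_) ĥj≡a ⟨
          perm g ⟨$⟩ʳ ĥ j    ≡⟨ ĥ-intertwines j ⟨
          ĥ (perm gʰ ⟨$⟩ʳ j) ≡⟨ cong ĥ τj≡j ⟩
          ĥ j                ≡⟨ ĥj≡a ⟩
          a                  ∎)
        a∈ĥbs : a ∈ map ĥ bs
        a∈ĥbs = subst (_∈ map ĥ bs) ĥj≡a (∈-map⁺ ĥ (moved⇒∈ gʰ cʰ j-moved))
        meeting = sign-meeting-cycles g (cyc , 2∣len , 2∣col) (cycle-map-ĥ cycʰ) (here refl) a∈ĥbs
        as↭ĥbs = proj₁ meeting

      parity-signDecomp-gʰ : ∀ {E} → All (IsCycleOf gʰ) E → All (λ bs → 2 ∣ length bs) E →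
                      parity (signDecomp gʰ E) ≡ parity (signDecomp g (map (map ĥ) E) + sum (map (z h) (concat E)))
      parity-signDecomp-gʰ []                    []              = refl
      parity-signDecomp-gʰ {bs ∷ E} (cycʰ ∷ cE) (2∣len ∷ 2∣lens) = begin
        parity (sign gʰ bs + signDecomp gʰ E)
          ≡⟨ parity-+-cong (sign gʰ bs) (S + Z) (signDecomp gʰ E) (S′ + Z′)
                           (parity-sign-gʰ cycʰ 2∣len) (parity-signDecomp-gʰ cE 2∣lens) ⟩
        parity ((S + Z) + (S′ + Z′))      ≡⟨ cong parity (interchange S Z S′ Z′) ⟩
        parity ((S + S′) + (Z + Z′))      ≡⟨ cong (λ t → parity (S + S′ + t)) Z+Z′ ⟨
        parity ((S + S′) + sum (map (z h) (bs ++ concat E))) ∎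
        where
        S  = sign g (map ĥ bs)
        S′ = signDecomp g (map (map ĥ) E)
        Z  = sum (map (z h) bs)
        Z′ = sum (map (z h) (concat E))
        Z+Z′ : sum (map (z h) (bs ++ concat E)) ≡ Z + Z′
        Z+Z′ = trans (cong sum (map-++ (z h) bs (concat E))) (sum-++ (map (z h) bs) _)

      signDecomp-conjugate : ∀ {D D′} → IsCycleDecomp g D → All (EvenCycleOf g) D → IsCycleDecomp gʰ D′ →
                             signDecomp gʰ D′ ≡₂ signDecomp g D + zTot h
      signDecomp-conjugate {D} {D′} (_ , D↭allFin) evD (cD′ , D′↭allFin) =
        parity⇒≡₂ (signDecomp gʰ D′) (signDecomp g D + zTot h) (begin
          parity (signDecomp gʰ D′)
            ≡⟨ parity-signDecomp-gʰ cD′ (All.map (λ {bs} ev → subst (2 ∣_) (length-map ĥ bs) (proj₁ (proj₂ ev)))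
                                          (All-map⁻ (proj₁ matching))) ⟩
          parity (signDecomp g (map (map ĥ) D′) + sum (map (z h) (concat D′)))
            ≡⟨ parity-+-cong (signDecomp g (map (map ĥ) D′)) (signDecomp g D) (sum (map (z h) (concat D′))) (zTot h)
                             (proj₂ matching) (cong parity (sum-↭ (map⁺ (z h) D′↭allFin))) ⟩
          parity (signDecomp g D + zTot h) ∎)
        where
        D↭ĥD′ : concat D ↭ concat (map (map ĥ) D′)
        D↭ĥD′ = ↭-trans D↭allFin (↭-trans (↭-sym ĥ-allFin)
                  (↭-trans (map⁺ ĥ (↭-sym D′↭allFin)) (↭-reflexive (sym (concat-map D′)))))
        matching = signDecomp-↭ g evD (All-map⁺ (All.map cycle-map-ĥ cD′)) D↭ĥD′

lemma5p1 : (r n : ℕ) ⦃ _ : NonZero r ⦄ → 2 ∣ r →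
    ((c h : G r n) (as : List (Fin n)) →
    IsCycle c as → 2 ∣ length as → 2 ∣ colour c as →
    (bs : List (Fin n)) → IsCycle ((h ⁻¹ · c) · h) bs →
    sign ((h ⁻¹ · c) · h) bs ≡₂ (sign c as + sumOverPreimage h as))
    × ((g h : G r n) (D : List (List (Fin n))) →
    IsCycleDecomp g D → All (EvenCycleOf g) D →
    (D′ : List (List (Fin n))) → IsCycleDecomp ((h ⁻¹ · g) · h) D′ →
    signDecomp ((h ⁻¹ · g) · h) D′ ≡₂ (signDecomp g D + zTot h))
lemma5p1 r n 2∣r =
  (λ c h _ cycle 2∣len 2∣col _ cycleʰ → ConjugationBy.sign-conjugate-cycle h c 2∣r cycle 2∣len 2∣col cycleʰ) ,
  (λ g h _ decomp even _ decompʰ → ConjugationBy.signDecomp-conjugate h g 2∣r decomp even decompʰ)
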